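{- Let $K$ be a field, $E=K\langle e_1,\dots,e_n\rangle$ the exterior algebra, and let $0\neq J\subsetneq E$ be a strongly stable monomial ideal. Then $$d(E/J)=n-\max\{\min(u): u\in G(J)\}.$$
   Context: $E$ is standard graded with $\deg e_i=1$. Monomials of $E$ are the elements $e_S=e_{j_1}\wedge\dots\wedge e_{j_t}$ for $S=\{j_1<\dots<j_t\}\subseteq[n]$. For a monomial $u$, $\operatorname{supp}(u)=\{i: e_i\mid u\}$ and $\min(u)=\min\operatorname{supp}(u)$. $G(J)$ is the unique minimal set of monomial generators of a monomial ideal $J$. A monomial ideal $J$ is strongly stable if $e_j\, u/e_i\in J$ for every monomial $u\in J$, every $i\in\operatorname{supp}(u)$ and every $j<i$. For a graded module $N$, $d(N)=\max\{i\in\mathbb{Z}: N_i\neq 0\}$. -}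

module Defs where

open import Data.Nat using (ℕ; suc; _≤_)
open import Data.Bool using (Bool; true)
open import Data.Fin using (Fin; toℕ) renaming (_<_ to _<ᶠ_; _≤_ to _≤ᶠ_)
open import Data.Fin.Subset using (Subset; _∈_; _∉_; _⊆_; _⊂_; ⊥; ∣_∣; inside; outside)
open import Data.Vec using (_[_]≔_)
open import Data.Product using (Σ; ∃; _×_)
open import Relation.Binary.PropositionalEquality using (_≡_)
open import Relation.Nullary using (¬_)

-- Monomials of E = K<e_1,...,e_n> are e_S for S ⊆ [n]; we index [n] by Fin n
-- (so e_{k+1} of the paper corresponds to k : Fin n).
-- A monomial ideal J of E is determined by (and determines) the set of monomials
-- it contains; we represent it by its characteristic function on monomials.
MonSet : ℕ → Set
MonSet n = Subset n → Bool

_∈J_ : {n : ℕ} → Subset n → MonSet n → Set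
S ∈J J = J S ≡ true

_∉J_ : {n : ℕ} → Subset n → MonSet n → Set
S ∉J J = ¬ (S ∈J J)

-- The set of monomials of a monomial ideal: closed under multiplication by
-- monomials, i.e. e_T * e_S = ± e_{S ∪ T} (or 0) lies in J; equivalently up-closed.
IsMonomialIdeal : {n : ℕ} → MonSet n → Set
IsMonomialIdeal {n} J = (S T : Subset n) → S ∈J J → S ⊆ T → T ∈J J

NonZeroIdeal : {n : ℕ} → MonSet n → Set
NonZeroIdeal {n} J = ∃ λ (S : Subset n) → S ∈J J

-- J ≠ E : 1 = e_∅ ∉ J.
ProperIdeal : {n : ℕ} → MonSet n → Set
ProperIdeal J = ⊥ ∉J J

-- Strongly stable: e_j u / e_i ∈ J for u ∈ J, i ∈ supp u, j < i.
-- If j ∈ supp u then e_j u/e_i = 0 ∈ J trivially; otherwise it is ± e_{(S∖{i})∪{j}}.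
StronglyStable : {n : ℕ} → MonSet n → Set
StronglyStable {n} J =
  (S : Subset n) (i j : Fin n) → S ∈J J → i ∈ S → j <ᶠ i → j ∉ S →
  ((S [ i ]≔ outside) [ j ]≔ inside) ∈J J

InG : {n : ℕ} → MonSet n → Subset n → Set
InG {n} J S = S ∈J J × ((T : Subset n) → T ⊂ S → T ∉J J)

-- min(u) = m, with the paper's 1-based indexing: m = toℕ k + 1 where k is the
-- least element of supp u.
HasMin : {n : ℕ} → Subset n → ℕ → Set
HasMin {n} S m = Σ (Fin n) λ k → k ∈ S × ((j : Fin n) → j ∈ S → k ≤ᶠ j) × m ≡ suc (toℕ k)

IsMaxMinG : {n : ℕ} → MonSet n → ℕ → Set
IsMaxMinG {n} J m =
  (∃ λ (S : Subset n) → InG J S × HasMin S m) ×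
  ((S : Subset n) (m' : ℕ) → InG J S → HasMin S m' → m' ≤ m)

-- (E/J)_i ≠ 0 : E/J has K-basis the monomials not in J, so (E/J)_i ≠ 0 iff
-- some monomial of degree i is not in J.
QuotNonzeroIn : {n : ℕ} → MonSet n → ℕ → Set
QuotNonzeroIn {n} J i = ∃ λ (S : Subset n) → S ∉J J × ∣ S ∣ ≡ i

IsTopDegreeQuot : {n : ℕ} → MonSet n → ℕ → Set
IsTopDegreeQuot J d = QuotNonzeroIn J d × ((i : ℕ) → QuotNonzeroIn J i → i ≤ d)

-- Let k be largest such that the tail monomial e_{k+1} ∧ ⋯ ∧ e_n lies in J
-- (it exists since 1 ∉ J ∋ e_1 ∧ ⋯ ∧ e_n).  Minimal generators dividing this tail have
-- minimum k + 1, while any monomial of J with larger minimum would divide the next tail,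
-- which is not in J; so max min G(J) = k + 1.  Strong stability lets one trade an index of
-- the tail missing from u for a smaller index of u outside the tail, so every monomial of
-- degree at least n − k is in J, whereas the next tail, of degree n − k − 1, is not.
module Submission where

open import Defs
open import Data.Nat using (ℕ; zero; suc; _∸_; _≤_; _<_; z≤n; s≤s)
open import Data.Nat.Properties
  using (≤-refl; ≤-trans; ≤-reflexive; ≤-antisym; ≤-pred; <-≤-trans; ≤⇒≯; ≰⇒>; ≮⇒≥)
open import Data.Nat.Induction using (<-wellFounded)
open import Data.Bool using (true) renaming (_≟_ to _≟ᵇ_)
open import Data.Fin using (Fin; toℕ; zero; suc)
open import Data.Fin.Properties using (any?)
open import Data.Fin.Subset
  using (Subset; Side; inside; outside; _∈_; _∉_; _⊆_; _⊂_; _∩_; ∁; _-_; ⁅_⁆; ⊤; ⊥; ∣_∣)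
open import Data.Fin.Subset.Properties
  using (_∈?_; ⊆-trans; ⊆⊤; p─q⊆p; x∈p∧x≢y⇒x∈p-y; x∈p⇒∣p-x∣<∣p∣; p⊂q⇒∣p∣<∣q∣;
         x∈p∩q⁺; x∈p∩q⁻; x∈∁p⇒x∉p; x∉p⇒x∈∁p)
open import Data.Vec using ([]; _∷_; here; there; lookup; _[_]≔_)
open import Data.Vec.Properties
  using ([]≔-idempotent; []≔-updates; []≔-minimal; []≔-lookup; lookup∘update′;
         []=-injective; []=⇒lookup; lookup⇒[]=)
open import Data.Product using (Σ; _×_; _,_; proj₂; ∃)
open import Data.Sum using (_⊎_; inj₁; inj₂)
open import Function using (id; _∘_)
open import Induction.WellFounded using (Acc; acc)
open import Relation.Nullary using (¬_; yes; no; contradiction)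
open import Relation.Nullary.Decidable using (_×-dec_; ¬?; decidable-stable)
open import Relation.Unary using (Decidable)
open import Relation.Binary.PropositionalEquality

private
  variable
    n : ℕ

lastBefore : (P : ℕ → Set) → Decidable P → P 0 → ¬ P n → ∃ λ k → P k × ¬ P (suc k)
lastBefore {zero}  P P? P0 ¬Pn = contradiction P0 ¬Pn
lastBefore {suc n} P P? P0 ¬P1+n with P? n
... | yes Pn = n , Pn , ¬P1+n
... | no ¬Pn = lastBefore P P? P0 ¬Pn

m∸n≤1+[m∸1+n] : ∀ m n → m ∸ n ≤ suc (m ∸ suc n)
m∸n≤1+[m∸1+n] zero    zero    = z≤n
m∸n≤1+[m∸1+n] zero    (suc n) = z≤n
m∸n≤1+[m∸1+n] (suc m) zero    = ≤-refl
m∸n≤1+[m∸1+n] (suc m) (suc n) = m∸n≤1+[m∸1+n] m n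

⊆-or-∉ : (p q : Subset n) → p ⊆ q ⊎ ∃ λ x → x ∈ p × x ∉ q
⊆-or-∉ p q with any? (λ x → (x ∈? p) ×-dec ¬? (x ∈? q))
... | yes witness = inj₂ witness
... | no ¬witness = inj₁ λ {x} x∈p →
  decidable-stable (x ∈? q) λ x∉q → ¬witness (x , x∈p , x∉q)

∉⇒lookup≡outside : {p : Subset n} {x : Fin n} → x ∉ p → lookup p x ≡ outside
∉⇒lookup≡outside {p = p} {x} x∉p with lookup p x in eq
... | inside  = contradiction (lookup⇒[]= x p eq) x∉p
... | outside = refl

x∉p[x]≔outside : (p : Subset n) (x : Fin n) → x ∉ p [ x ]≔ outside
x∉p[x]≔outside p x x∈ with []=-injective x∈ ([]≔-updates p x)
... | ()

x∈p[y]≔v⇒x∈p : {p : Subset n} {x y : Fin n} {v : Side} → x ≢ y → x ∈ p [ y ]≔ v → x ∈ p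
x∈p[y]≔v⇒x∈p {p = p} {x} {v = v} x≢y x∈ =
  lookup⇒[]= x p (trans (sym (lookup∘update′ x≢y p v)) ([]=⇒lookup x∈))

∣p[x]≔inside∣ : (p : Subset n) (x : Fin n) → x ∉ p → ∣ p [ x ]≔ inside ∣ ≡ suc ∣ p ∣
∣p[x]≔inside∣ (inside  ∷ p) zero    x∉p = contradiction here x∉p
∣p[x]≔inside∣ (outside ∷ p) zero    x∉p = refl
∣p[x]≔inside∣ (inside  ∷ p) (suc x) x∉p = cong suc (∣p[x]≔inside∣ p x (x∉p ∘ there))
∣p[x]≔inside∣ (outside ∷ p) (suc x) x∉p = ∣p[x]≔inside∣ p x (x∉p ∘ there)

∣p[x]≔outside∣ : (p : Subset n) (x : Fin n) → x ∈ p → suc ∣ p [ x ]≔ outside ∣ ≡ ∣ p ∣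
∣p[x]≔outside∣ (inside  ∷ p) zero    x∈p         = refl
∣p[x]≔outside∣ (inside  ∷ p) (suc x) (there x∈p) = cong suc (∣p[x]≔outside∣ p x x∈p)
∣p[x]≔outside∣ (outside ∷ p) (suc x) (there x∈p) = ∣p[x]≔outside∣ p x x∈p

exchange : Subset n → Fin n → Fin n → Subset n
exchange u j i = (u [ j ]≔ outside) [ i ]≔ inside

module _ {u : Subset n} {i j : Fin n} (j∈u : j ∈ u) (i∉u : i ∉ u) where

  private
    i≢j : i ≢ j
    i≢j refl = i∉u j∈u

    i∉u[j]≔outside : i ∉ u [ j ]≔ outside
    i∉u[j]≔outside = i∉u ∘ x∈p[y]≔v⇒x∈p i≢j

  ∣exchange∣ : ∣ exchange u j i ∣ ≡ ∣ u ∣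
  ∣exchange∣ = trans (∣p[x]≔inside∣ _ i i∉u[j]≔outside) (∣p[x]≔outside∣ u j j∈u)

  j∉exchange : j ∉ exchange u j i
  j∉exchange = x∉p[x]≔outside u j ∘ x∈p[y]≔v⇒x∈p (i≢j ∘ sym)

  exchange-undo : (exchange u j i [ i ]≔ outside) [ j ]≔ inside ≡ u
  exchange-undo = begin
    ((u₋ [ i ]≔ inside) [ i ]≔ outside) [ j ]≔ inside ≡⟨ cong (_[ j ]≔ inside) ([]≔-idempotent u₋ i) ⟩
    (u₋ [ i ]≔ outside) [ j ]≔ inside                ≡⟨ cong (λ s → (u₋ [ i ]≔ s) [ j ]≔ inside) lookup-u₋-i ⟨
    (u₋ [ i ]≔ lookup u₋ i) [ j ]≔ inside            ≡⟨ cong (_[ j ]≔ inside) ([]≔-lookup u₋ i) ⟩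
    u₋ [ j ]≔ inside                                 ≡⟨ []≔-idempotent u j ⟩
    u [ j ]≔ inside                                  ≡⟨ cong (u [ j ]≔_) ([]=⇒lookup j∈u) ⟨
    u [ j ]≔ lookup u j                              ≡⟨ []≔-lookup u j ⟩
    u                                                ∎
    where
    open ≡-Reasoning
    u₋ : Subset n
    u₋ = u [ j ]≔ outside
    lookup-u₋-i : lookup u₋ i ≡ outside
    lookup-u₋-i = trans (lookup∘update′ i≢j u outside) (∉⇒lookup≡outside i∉u)

∈J-exchange⇒∈J : {J : MonSet n} {u : Subset n} {i j : Fin n} → StronglyStable J →
                 toℕ j < toℕ i → j ∈ u → i ∉ u → exchange u j i ∈J J → u ∈J J
∈J-exchange⇒∈J {J = J} {i = i} {j} stable j<i j∈u i∉u u′∈J =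
  subst (_∈J J) (exchange-undo j∈u i∉u)
    (stable _ i j u′∈J ([]≔-updates _ i) j<i (j∉exchange j∈u i∉u))

exchange-missing⊂ : {t u : Subset n} {i j : Fin n} →
                    i ∈ t → j ∉ t → i ∉ u → t ∩ ∁ (exchange u j i) ⊂ t ∩ ∁ u
exchange-missing⊂ {t = t} {u} {i} {j} i∈t j∉t i∉u =
  missing′⊆missing , i , x∈p∩q⁺ (i∈t , x∉p⇒x∈∁p i∉u) , λ i∈ → x∈∁p⇒x∉p (proj₂ (x∈p∩q⁻ t _ i∈)) i∈u′
  where
  i∈u′ : i ∈ exchange u j i
  i∈u′ = []≔-updates _ i
  missing′⊆missing : t ∩ ∁ (exchange u j i) ⊆ t ∩ ∁ u
  missing′⊆missing {x} x∈ with x∈p∩q⁻ t _ x∈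
  ... | x∈t , x∉u′ = x∈p∩q⁺ (x∈t , x∉p⇒x∈∁p λ x∈u →
    x∈∁p⇒x∉p x∉u′ ([]≔-minimal _ x i (λ { refl → i∉u x∈u })
                    ([]≔-minimal u x j (λ { refl → j∉t x∈t }) x∈u)))

-- atLeast k is the support {k, k+1, …, n-1} of e_{k+1} ∧ ⋯ ∧ e_n.
atLeast : ℕ → Subset n
atLeast {zero}  k       = []
atLeast {suc n} zero    = inside ∷ atLeast zero
atLeast {suc n} (suc k) = outside ∷ atLeast k

∈atLeast⁺ : {k : ℕ} {x : Fin n} → k ≤ toℕ x → x ∈ atLeast k
∈atLeast⁺ {suc n} {zero}  {zero}  _         = here
∈atLeast⁺ {suc n} {zero}  {suc x} _         = there (∈atLeast⁺ z≤n)
∈atLeast⁺ {suc n} {suc k} {suc x} (s≤s k≤x) = there (∈atLeast⁺ k≤x)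

∈atLeast⁻ : {k : ℕ} {x : Fin n} → x ∈ atLeast k → k ≤ toℕ x
∈atLeast⁻ {suc n} {zero}          _          = z≤n
∈atLeast⁻ {suc n} {suc k} {suc x} (there x∈) = s≤s (∈atLeast⁻ x∈)

∣atLeast∣ : (n k : ℕ) → ∣ atLeast {n} k ∣ ≡ n ∸ k
∣atLeast∣ zero    zero    = refl
∣atLeast∣ zero    (suc k) = refl
∣atLeast∣ (suc n) zero    = cong suc (∣atLeast∣ n zero)
∣atLeast∣ (suc n) (suc k) = ∣atLeast∣ n k

atLeast-0≡⊤ : atLeast {n} 0 ≡ ⊤
atLeast-0≡⊤ {zero}  = refl
atLeast-0≡⊤ {suc n} = cong (inside ∷_) atLeast-0≡⊤

atLeast-n≡⊥ : atLeast {n} n ≡ ⊥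
atLeast-n≡⊥ {zero}  = refl
atLeast-n≡⊥ {suc n} = cong (outside ∷_) atLeast-n≡⊥

⊆atLeast∧⊈atLeast-suc⇒HasMin : {s : Subset n} {k : ℕ} →
  s ⊆ atLeast k → ¬ s ⊆ atLeast (suc k) → HasMin s (suc k)
⊆atLeast∧⊈atLeast-suc⇒HasMin {s = s} {k} s⊆ s⊈ with ⊆-or-∉ s (atLeast (suc k))
... | inj₁ s⊆′ = contradiction (λ {x} → s⊆′ {x}) s⊈
... | inj₂ (x , x∈s , x∉) =
  x , x∈s , (λ y y∈s → subst (_≤ toℕ y) (sym x≡k) (∈atLeast⁻ (s⊆ y∈s))) , cong suc (sym x≡k)
  where
  x≡k : toℕ x ≡ k
  x≡k = ≤-antisym (≤-pred (≰⇒> (x∉ ∘ ∈atLeast⁺))) (∈atLeast⁻ (s⊆ x∈s))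

HasMin∧⊈atLeast⇒≤ : {s : Subset n} {m k : ℕ} → HasMin s m → ¬ s ⊆ atLeast k → m ≤ k
HasMin∧⊈atLeast⇒≤ (x , x∈s , least , refl) s⊈ =
  ≰⇒> λ k≤x → s⊈ λ {y} y∈s → ∈atLeast⁺ (≤-trans k≤x (least y y∈s))

module _ {J : MonSet n} (ideal : IsMonomialIdeal J) where

  ∃-generator⊆ : {s : Subset n} → s ∈J J → ∃ λ g → g ⊆ s × InG J g
  ∃-generator⊆ {s} s∈J = go s (<-wellFounded ∣ s ∣) s∈J
    where
    go : ∀ s → Acc _<_ ∣ s ∣ → s ∈J J → ∃ λ g → g ⊆ s × InG J g
    go s (acc smaller) s∈J with any? (λ x → (x ∈? s) ×-dec (J (s - x) ≟ᵇ true))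
    ... | yes (x , x∈s , s-x∈J) with go (s - x) (smaller (x∈p⇒∣p-x∣<∣p∣ x∈s)) s-x∈J
    ...   | g , g⊆ , g-gen = g , ⊆-trans g⊆ (p─q⊆p s ⁅ x ⁆) , g-gen
    go s _ s∈J | no s-minimal = s , id , s∈J , λ where
      t (t⊆s , x , x∈s , x∉t) t∈J → s-minimal (x , x∈s , ideal t (s - x) t∈J
        λ {y} y∈t → x∈p∧x≢y⇒x∈p-y (t⊆s y∈t) λ { refl → x∉t y∈t })

  module _ (stable : StronglyStable J) {k : ℕ} (atLeast-k∈J : atLeast k ∈J J) where

    ∣atLeast∣≤⇒∈J : {u : Subset n} → ∣ atLeast {n} k ∣ ≤ ∣ u ∣ → u ∈J J
    ∣atLeast∣≤⇒∈J {u} = go u (<-wellFounded ∣ t ∩ ∁ u ∣)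
      where
      t : Subset n
      t = atLeast k
      go : ∀ u → Acc _<_ ∣ t ∩ ∁ u ∣ → ∣ t ∣ ≤ ∣ u ∣ → u ∈J J
      go u (acc smaller) ∣t∣≤∣u∣ with ⊆-or-∉ t u
      ... | inj₁ t⊆u = ideal t u atLeast-k∈J t⊆u
      ... | inj₂ (i , i∈t , i∉u) with ⊆-or-∉ u t
      ...   | inj₁ u⊆t = contradiction (p⊂q⇒∣p∣<∣q∣ (u⊆t , i , i∈t , i∉u)) (≤⇒≯ ∣t∣≤∣u∣)
      ...   | inj₂ (j , j∈u , j∉t) =
        ∈J-exchange⇒∈J stable j<i j∈u i∉u
          (go (exchange u j i)
              (smaller (p⊂q⇒∣p∣<∣q∣ (exchange-missing⊂ i∈t j∉t i∉u)))
              (≤-trans ∣t∣≤∣u∣ (≤-reflexive (sym (∣exchange∣ j∈u i∉u)))))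
        where
        j<i : toℕ j < toℕ i
        j<i = <-≤-trans (≰⇒> (j∉t ∘ ∈atLeast⁺)) (∈atLeast⁻ i∈t)

proposition3p5 : (n : ℕ) (J : MonSet n) →
    IsMonomialIdeal J → NonZeroIdeal J → ProperIdeal J → StronglyStable J →
    Σ ℕ λ m → IsMaxMinG J m × IsTopDegreeQuot J (n ∸ m)
proposition3p5 n J ideal (s , s∈J) proper stable
  with k , atLeast-k∈J , atLeast-1+k∉J ← lastBefore (λ k → atLeast k ∈J J)
         (λ k → J (atLeast k) ≟ᵇ true)
         (subst (_∈J J) (sym atLeast-0≡⊤) (ideal s ⊤ s∈J ⊆⊤))
         (subst (_∉J J) (sym atLeast-n≡⊥) proper)
  with g , g⊆atLeast-k , g-gen ← ∃-generator⊆ ideal atLeast-k∈J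
  = suc k , ((g , g-gen , ⊆atLeast∧⊈atLeast-suc⇒HasMin g⊆atLeast-k (⊈atLeast-1+k g-gen)) , max)
  , (atLeast (suc k) , atLeast-1+k∉J , ∣atLeast∣ n (suc k)) , top
  where
  ⊈atLeast-1+k : {u : Subset n} → InG J u → ¬ u ⊆ atLeast (suc k)
  ⊈atLeast-1+k (u∈J , _) u⊆ = atLeast-1+k∉J (ideal _ _ u∈J u⊆)
  max : (u : Subset n) (m : ℕ) → InG J u → HasMin u m → m ≤ suc k
  max u m u-gen u-min = HasMin∧⊈atLeast⇒≤ u-min (⊈atLeast-1+k u-gen)
  top : (d : ℕ) → QuotNonzeroIn J d → d ≤ n ∸ suc k
  top _ (u , u∉J , refl) = ≮⇒≥ λ n∸[1+k]<∣u∣ → u∉J (∣atLeast∣≤⇒∈J ideal stable atLeast-k∈J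
    (≤-trans (≤-trans (≤-reflexive (∣atLeast∣ n k)) (m∸n≤1+[m∸1+n] n k)) n∸[1+k]<∣u∣))
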